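{- Let $G$ be a matching covered graph, let $C$ be a tight cut of $G$, and let $S$ be a set of vertices of $G$ that is either a 2-separation or a barrier of $G$. If $S$ is $C$-sheltered, then some cut associated with $S$ has a shore that is a superset of a shore of $C$, say $X$, and all the other cuts associated with $S$ have a shore that is a subset of $\overline{X}$. Consequently, if $S$ is $C$-sheltered then $S$ is $C$-avoiding.
   Context: Graphs are finite, may have multiple edges, no loops. For $X\subseteq V(G)$, $\overline{X}=V(G)-X$, $\partial(X)$ is the set of edges with exactly one end in $X$; cuts are sets $\partial(X)$, with shores $X,\overline{X}$. Two cuts $\partial(X),\partial(Y)$ are laminar if at least one of $X\cap Y,\overline{X}\cap Y,X\cap\overline{Y},\overline{X}\cap\overline{Y}$ is empty. A matching covered graph is a connected graph with at least one edge in which every edge lies in some perfect matching. A cut $C$ is tight if $|C\cap M|=1$ for every perfect matching $M$. A barrier is a nonempty vertex set $B$ with $o(G-B)=|B|$ ($o$ = number of odd components); the cuts associated with a barrier $B$ are the cuts $\partial(V(H))$ for $H$ a component of $G-B$. A 2-separation is a pair $\{u,v\}$ of vertices such that $G-\{u,v\}$ is disconnected and all its components are even; the cuts associated with it are $\partial(V(G_1)\cup\{u\})$ and $\partial(V(G_1)\cup\{v\})$ where $\{G_1,G_2\}$ is a partition of $G-\{u,v\}$ into two nonempty unions of components. $S$ is $C$-sheltered if $S$ is a subset of a shore of $C$, and $C$-avoiding if every cut associated with $S$ is laminar with $C$. -}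

module Defs where

open import Data.Nat using (ℕ; _%_)
open import Data.Bool using (Bool; true; false; _∧_; _xor_)
open import Data.Fin using (Fin)
open import Data.Fin.Properties using (_≟_)
open import Data.Fin.Subset using (Subset; _∈_; _⊆_; ∁; _∩_; _∪_; ∣_∣; ⁅_⁆; Nonempty; Empty)
open import Data.Vec using (lookup; tabulate)
open import Data.Product using (Σ; ∃; ∃-syntax; _×_; _,_; proj₁; proj₂)
open import Data.Sum using (_⊎_)
open import Data.List using (List; length)
open import Data.List.Relation.Unary.Unique.Propositional using (Unique)
import Data.List.Membership.Propositional as LM
open import Relation.Nullary using (¬_; ⌊_⌋)
open import Relation.Binary.PropositionalEquality using (_≡_; _≢_)
open import Function.Bundles using (_⇔_)

-- A finite loopless multigraph with vertex set Fin n and edge set Fin m;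
-- each edge has two (distinct) ends.  Parallel edges are allowed.
record Graph (n m : ℕ) : Set where
  field
    ends     : Fin m → Fin n × Fin n
    loopless : ∀ e → proj₁ (ends e) ≢ proj₂ (ends e)
open Graph public

module _ {n m : ℕ} (G : Graph n m) where

  Joins : Fin m → Fin n → Fin n → Set
  Joins e u w = (ends G e ≡ (u , w)) ⊎ (ends G e ≡ (w , u))

  incident : Fin n → Fin m → Bool
  incident v e = ⌊ proj₁ (ends G e) ≟ v ⌋ Data.Bool.∨ ⌊ proj₂ (ends G e) ≟ v ⌋

  ∂ : Subset n → Subset m
  ∂ X = tabulate (λ e → lookup X (proj₁ (ends G e)) xor lookup X (proj₂ (ends G e)))

  -- walks all of whose vertices lie in W (walks in the induced subgraph G[W])
  data Walk (W : Subset n) : Fin n → Fin n → Set where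
    stop : ∀ {u} → u ∈ W → Walk W u u
    step : ∀ {u w v} (e : Fin m) → Joins e u w → u ∈ W → Walk W w v → Walk W u v

  Connected : Set
  Connected = ∀ u v → Walk (∁ (Data.Fin.Subset.⊥)) u v

  PerfectMatching : Subset m → Set
  PerfectMatching M = ∀ v → ∣ tabulate (λ e → lookup M e ∧ incident v e) ∣ ≡ 1

  MatchingCovered : Set
  MatchingCovered = Connected × Fin m × (∀ e → ∃[ M ] (PerfectMatching M × e ∈ M))

  IsShore : Subset m → Subset n → Set
  IsShore C X = ∂ X ≡ C

  IsCut : Subset m → Set
  IsCut C = ∃[ X ] IsShore C X

  Tight : Subset m → Set
  Tight C = ∀ M → PerfectMatching M → ∣ C ∩ M ∣ ≡ 1

  IsComponent : Subset n → Subset n → Set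
  IsComponent W K =
    K ⊆ W × Nonempty K
    × (∀ {x y} → x ∈ K → y ∈ K → Walk W x y)
    × (∀ {x y} → x ∈ K → Walk W x y → y ∈ K)

  Odd Even : ℕ → Set
  Odd k = k % 2 ≡ 1
  Even k = k % 2 ≡ 0

  IsBarrier : Subset n → Set
  IsBarrier B = Nonempty B ×
    ∃[ L ] (Unique L × length L ≡ ∣ B ∣
      × (∀ K → (K LM.∈ L) ⇔ (IsComponent (∁ B) K × Odd ∣ K ∣)))

  Is2SepPair : Fin n → Fin n → Subset n → Set
  Is2SepPair u v S = u ≢ v × S ≡ (⁅ u ⁆ ∪ ⁅ v ⁆)
    × (∃[ x ] ∃[ y ] (x ∈ ∁ S × y ∈ ∁ S × ¬ Walk (∁ S) x y))
    × (∀ K → IsComponent (∁ S) K → Even ∣ K ∣)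

  Is2Sep : Subset n → Set
  Is2Sep S = ∃[ u ] ∃[ v ] Is2SepPair u v S

  UnionOfComponents : Subset n → Subset n → Set
  UnionOfComponents S X1 = X1 ⊆ ∁ S ×
    (∀ K → IsComponent (∁ S) K → K ⊆ X1 ⊎ Empty (K ∩ X1))

  -- Y is a shore of a cut associated with S (S a 2-separation or a barrier);
  -- the associated cut is ∂ Y
  AssocShore : Subset n → Subset n → Set
  AssocShore S Y =
    (∃[ u ] ∃[ v ] (Is2SepPair u v S × ∃[ X1 ]
        (UnionOfComponents S X1 × Nonempty X1 × Nonempty (∁ S Data.Fin.Subset.─ X1)
         × Y ≡ (X1 ∪ ⁅ u ⁆))))
    ⊎ (IsBarrier S × IsComponent (∁ S) Y)

  Laminar : Subset n → Subset n → Set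
  Laminar X Y = Empty (X ∩ Y) ⊎ Empty (∁ X ∩ Y) ⊎ Empty (X ∩ ∁ Y) ⊎ Empty (∁ X ∩ ∁ Y)

  Sheltered : Subset n → Subset m → Set
  Sheltered S C = ∃[ Z ] (IsShore C Z × S ⊆ Z)

  Avoiding : Subset n → Subset m → Set
  Avoiding S C = ∀ Y → AssocShore S Y → ∀ X → IsShore C X → Laminar Y X

-- Take the shore X of C disjoint from S (the complement of the shore that shelters S).
-- Counting vertices of a set A against a perfect matching M gives |A| = |M ∩ ∂A| + 2k,
-- so |M ∩ ∂A| has the same parity for all M. Hence if X met two components of G - S,
-- splitting X along one of them would split the tight cut ∂X into two cuts each met at
-- most once, hence (by parity and matching-coveredness) each met exactly once by every
-- perfect matching: impossible. So X lies inside one component K of G - S. Every cut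
-- associated with S has a shore that contains K or misses it, hence contains X or misses
-- it; and a shore of C is X or its complement, which gives laminarity.
module Submission where

open import Defs
open import Data.Nat.Properties
  using (+-*-semiring; ≤-reflexive; ≤-antisym; m≤m+n; m≤n+m; even≢odd; +-identityʳ)
open import Algebra.Properties.Semiring.Sum +-*-semiring
  using (sum; sum-cong-≗; sum-replicate-zero; ∑-comm; ∑-distrib-+; *-distribˡ-sum)
open import Data.Bool using (Bool; true; false; not; _∧_; _∨_; _xor_)
open import Data.Bool.Properties using (∧-zeroʳ; ∧-identityʳ; not-involutive; xor-same; ¬-not)
import Data.Bool.Properties as Bool
open import Data.Empty using (⊥; ⊥-elim)
open import Data.Fin using (Fin; zero; suc)
open import Data.Fin.Properties using (_≟_; any?; ¬∀⟶∃¬)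
open import Data.Fin.Subset
  using (Subset; _∈_; _∉_; _⊆_; _⊂_; ∁; _∩_; _∪_; _─_; _-_; ⁅_⁆; ∣_∣; Nonempty; Empty)
open import Data.Fin.Subset.Induction using (⊂-wellFounded)
open import Data.Fin.Subset.Properties
  using (_∈?_; nonempty?; Empty-unique; ∣⊥∣≡0; ∣⁅x⁆∣≡1; p⊆q⇒∣p∣≤∣q∣; x∈⁅x⁆; x∈⁅y⁆⇒x≡y;
         x∈p∩q⁺; x∈p∩q⁻; p∩q⊆p; x∈p∪q⁺; x∈p∪q⁻; p⊆p∪q; x∈∁p⇒x∉p; x∉p⇒x∈∁p;
         p⊆q⇒∁p⊇∁q; x∈p∧x∉q⇒x∈p─q; x∈p∧x≢y⇒x∈p-y; p─q⊆p; x∈p⇒p-x⊂p)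
open import Data.Nat using (ℕ; zero; suc; _+_; _*_; _≤_; s≤s)
open import Data.Product using (∃-syntax; _×_; _,_; proj₁; proj₂)
open import Data.Product.Properties using (≡-dec)
open import Data.Sum using (_⊎_; inj₁; inj₂; [_,_]′)
open import Data.Vec using ([]; _∷_; lookup; tabulate)
open import Data.Vec.Properties
  using (lookup∘tabulate; tabulate∘lookup; tabulate-cong; lookup-zipWith; lookup-map;
         []=⇒lookup; lookup⇒[]=)
open import Function using (_∘_; id)
open import Induction.WellFounded using (Acc; acc)
open import Relation.Nullary using (¬_; Dec; yes; no; does; ⌊_⌋; ¬?; _×-dec_; _⊎-dec_)
open import Relation.Nullary.Decidable using (map′; dec-true; decidable-stable)
open import Relation.Binary.PropositionalEquality
  using (_≡_; _≢_; _≗_; refl; sym; trans; cong; cong₂; subst; module ≡-Reasoning)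

toℕ : Bool → ℕ
toℕ true  = 1
toℕ false = 0

count : ∀ {k} → (Fin k → Bool) → ℕ
count f = sum (toℕ ∘ f)

count-cong : ∀ {k} {f g : Fin k → Bool} → f ≗ g → count f ≡ count g
count-cong f≗g = sum-cong-≗ (cong toℕ ∘ f≗g)

count-false : ∀ k → count {k} (λ _ → false) ≡ 0
count-false k = sum-replicate-zero k

∣p∣≡count : ∀ {k} (p : Subset k) → ∣ p ∣ ≡ count (lookup p)
∣p∣≡count []          = refl
∣p∣≡count (true  ∷ p) = cong suc (∣p∣≡count p)
∣p∣≡count (false ∷ p) = ∣p∣≡count p

∣tabulate∣≡count : ∀ {k} (f : Fin k → Bool) → ∣ tabulate f ∣ ≡ count f
∣tabulate∣≡count f = trans (∣p∣≡count (tabulate f)) (count-cong (lookup∘tabulate f))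

-- Stated with does, not ⌊_⌋: only does reduces through the suc case of Fin's _≟_.
count-indicator : ∀ {k} (f : Fin k → Bool) a → count (λ v → does (a ≟ v) ∧ f v) ≡ toℕ (f a)
count-indicator {suc k} f zero    =
  trans (cong (toℕ (f zero) +_) (count-false k)) (+-identityʳ _)
count-indicator {suc k} f (suc a) = count-indicator (f ∘ suc) a

∈⇒1≤∣p∣ : ∀ {k} {x : Fin k} {p : Subset k} → x ∈ p → 1 ≤ ∣ p ∣
∈⇒1≤∣p∣ {x = x} x∈p =
  subst (_≤ _) (∣⁅x⁆∣≡1 x) (p⊆q⇒∣p∣≤∣q∣ (λ y∈⁅x⁆ → subst (_∈ _) (sym (x∈⁅y⁆⇒x≡y x y∈⁅x⁆)) x∈p))

1≤∣p∣⇒Nonempty : ∀ {k} {p : Subset k} → 1 ≤ ∣ p ∣ → Nonempty p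
1≤∣p∣⇒Nonempty {k} {p} 1≤∣p∣ with nonempty? p
... | yes ne = ne
... | no ¬ne with () ← subst (1 ≤_) (trans (cong ∣_∣ (Empty-unique ¬ne)) (∣⊥∣≡0 k)) 1≤∣p∣

∉⇒lookup≡false : ∀ {k} {x : Fin k} {p : Subset k} → x ∉ p → lookup p x ≡ false
∉⇒lookup≡false {x = x} {p} x∉p with lookup p x in eq
... | true  = ⊥-elim (x∉p (lookup⇒[]= x p eq))
... | false = refl

∈-tabulate⁺ : ∀ {k} {f : Fin k → Bool} {x} → f x ≡ true → x ∈ tabulate f
∈-tabulate⁺ {f = f} {x} fx = lookup⇒[]= x _ (trans (lookup∘tabulate f x) fx)

∈-tabulate⁻ : ∀ {k} {f : Fin k → Bool} {x} → x ∈ tabulate f → f x ≡ true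
∈-tabulate⁻ {f = f} {x} x∈ = trans (sym (lookup∘tabulate f x)) ([]=⇒lookup x∈)

≗⇒≡ : ∀ {k} {p q : Subset k} → lookup p ≗ lookup q → p ≡ q
≗⇒≡ {p = p} {q} p≗q = trans (sym (tabulate∘lookup p)) (trans (tabulate-cong p≗q) (tabulate∘lookup q))

∁-involutive : ∀ {k} (p : Subset k) → ∁ (∁ p) ≡ p
∁-involutive []          = refl
∁-involutive (true  ∷ p) = cong (true ∷_) (∁-involutive p)
∁-involutive (false ∷ p) = cong (false ∷_) (∁-involutive p)

Empty∩∁∁ : ∀ {k} {p q : Subset k} → Empty (p ∩ q) → Empty (p ∩ ∁ (∁ q))
Empty∩∁∁ {p = p} {q} = subst (λ r → Empty (p ∩ r)) (sym (∁-involutive q))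

⊆∁⇒Empty∩ : ∀ {k} {p q : Subset k} → p ⊆ ∁ q → Empty (p ∩ q)
⊆∁⇒Empty∩ {p = p} {q} p⊆∁q (x , x∈p∩q) =
  let x∈p , x∈q = x∈p∩q⁻ p q x∈p∩q in x∈∁p⇒x∉p (p⊆∁q x∈p) x∈q

⊆-Empty∩⇒⊆∁ : ∀ {k} {p q r : Subset k} → p ⊆ q → Empty (q ∩ r) → r ⊆ ∁ p
⊆-Empty∩⇒⊆∁ {p = p} p⊆q q∩r≡∅ {x} x∈r with x ∈? p
... | yes x∈p = ⊥-elim (q∩r≡∅ (x , x∈p∩q⁺ (p⊆q x∈p , x∈r)))
... | no  x∉p = x∉p⇒x∈∁p x∉p

xor≡false⇒≡ : ∀ {a b} → a xor b ≡ false → a ≡ b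
xor≡false⇒≡ {false} {false} _ = refl
xor≡false⇒≡ {true}  {true}  _ = refl

xor-interchange : ∀ a b c d → a xor b ≡ c xor d → a xor c ≡ b xor d
xor-interchange false false false false _ = refl
xor-interchange false false true  true  _ = refl
xor-interchange false true  false true  _ = refl
xor-interchange false true  true  false _ = refl
xor-interchange true  false false true  _ = refl
xor-interchange true  false true  false _ = refl
xor-interchange true  true  false false _ = refl
xor-interchange true  true  true  true  _ = refl

not-xor-not : ∀ a b → not a xor not b ≡ a xor b
not-xor-not false b = not-involutive b
not-xor-not true  b = refl

bits-of-matched-edge : ∀ m a b →
  toℕ (m ∧ a) + toℕ (m ∧ b) ≡ toℕ ((a xor b) ∧ m) + 2 * toℕ (m ∧ (a ∧ b))
bits-of-matched-edge false false false = refl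
bits-of-matched-edge false false true  = refl
bits-of-matched-edge false true  false = refl
bits-of-matched-edge false true  true  = refl
bits-of-matched-edge true  false false = refl
bits-of-matched-edge true  false true  = refl
bits-of-matched-edge true  true  false = refl
bits-of-matched-edge true  true  true  = refl

bits-of-split-edge : ∀ m a₁ a₂ k₁ k₂ → (a₁ ≡ true → a₂ ≡ true → k₁ ≡ k₂) →
  toℕ ((a₁ xor a₂) ∧ m) ≡
    toℕ (((a₁ ∧ k₁) xor (a₂ ∧ k₂)) ∧ m) + toℕ (((a₁ ∧ not k₁) xor (a₂ ∧ not k₂)) ∧ m)
bits-of-split-edge m     false false k₁    k₂    _ = refl
bits-of-split-edge false false true  k₁    false _ = refl
bits-of-split-edge false false true  k₁    true  _ = refl
bits-of-split-edge true  false true  k₁    false _ = refl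
bits-of-split-edge true  false true  k₁    true  _ = refl
bits-of-split-edge false true  false false k₂    _ = refl
bits-of-split-edge false true  false true  k₂    _ = refl
bits-of-split-edge true  true  false false k₂    _ = refl
bits-of-split-edge true  true  false true  k₂    _ = refl
bits-of-split-edge m     true  true  false false _ = refl
bits-of-split-edge m     true  true  true  true  _ = refl
bits-of-split-edge m     true  true  false true  h with () ← h refl refl
bits-of-split-edge m     true  true  true  false h with () ← h refl refl

odd-≤1⇒≡1 : ∀ {c k k′} → c ≤ 1 → c + 2 * k ≡ suc (2 * k′) → c ≡ 1
odd-≤1⇒≡1 {zero} {k} {k′} _ eq = ⊥-elim (even≢odd k k′ eq)
odd-≤1⇒≡1 {suc zero} _ _ = refl
odd-≤1⇒≡1 {suc (suc _)} (s≤s ()) _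

module _ {n m : ℕ} (G : Graph n m) where

  end₁ end₂ : Fin m → Fin n
  end₁ e = proj₁ (ends G e)
  end₂ e = proj₂ (ends G e)

  private variable
    W A K S X X′ Y : Subset n
    a b x y s : Fin n

  walk-start : Walk G W a b → a ∈ W
  walk-start (stop a∈W)       = a∈W
  walk-start (step _ _ a∈W _) = a∈W

  walk-end : Walk G W a b → b ∈ W
  walk-end (stop b∈W)     = b∈W
  walk-end (step _ _ _ p) = walk-end p

  walk-mono : W ⊆ A → Walk G W a b → Walk G A a b
  walk-mono W⊆A (stop a∈W)       = stop (W⊆A a∈W)
  walk-mono W⊆A (step e j a∈W p) = step e j (W⊆A a∈W) (walk-mono W⊆A p)

  walk-++ : Walk G W a b → Walk G W b y → Walk G W a y
  walk-++ (stop _)         q = q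
  walk-++ (step e j a∈W p) q = step e j a∈W (walk-++ p q)

  walk-reverse : Walk G W a b → Walk G W b a
  walk-reverse (stop a∈W)               = stop a∈W
  walk-reverse (step e (inj₁ eq) a∈W p) =
    walk-++ (walk-reverse p) (step e (inj₂ eq) (walk-start p) (stop a∈W))
  walk-reverse (step e (inj₂ eq) a∈W p) =
    walk-++ (walk-reverse p) (step e (inj₁ eq) (walk-start p) (stop a∈W))

  walk-invariant : ∀ {B : Set} (D : Fin n → B) → (∀ e → D (end₁ e) ≡ D (end₂ e)) →
    Walk G W a b → D a ≡ D b
  walk-invariant D inv (stop _)         = refl
  walk-invariant D inv (step e j _ p) = trans (along j) (walk-invariant D inv p)
    where
    along : ∀ {u w} → Joins G e u w → D u ≡ D w
    along (inj₁ eq) = subst (λ uw → D (proj₁ uw) ≡ D (proj₂ uw)) eq (inv e)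
    along (inj₂ eq) = sym (subst (λ uw → D (proj₁ uw) ≡ D (proj₂ uw)) eq (inv e))

  lookup-∂ : ∀ A e → lookup (∂ G A) e ≡ lookup A (end₁ e) xor lookup A (end₂ e)
  lookup-∂ A e = lookup∘tabulate (λ e → lookup A (end₁ e) xor lookup A (end₂ e)) e

  ∉∂⇒same-side : ∀ {e} → e ∉ ∂ G A → lookup A (end₁ e) ≡ lookup A (end₂ e)
  ∉∂⇒same-side {A} {e} e∉∂A = xor≡false⇒≡ (trans (sym (lookup-∂ A e)) (∉⇒lookup≡false e∉∂A))

  walk-leaves : Walk G W a b → a ∈ A → b ∉ A → ∃[ e ] e ∈ ∂ G A
  walk-leaves {A = A} p a∈A b∉A =
    let e , ¬e∉∂A = ¬∀⟶∃¬ m (λ e → e ∉ ∂ G A) (λ e → ¬? (e ∈? ∂ G A)) no-edge-leaves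
    in e , decidable-stable (e ∈? ∂ G A) ¬e∉∂A
    where
    no-edge-leaves : ¬ (∀ e → e ∉ ∂ G A)
    no-edge-leaves none = b∉A (lookup⇒[]= _ A
      (trans (sym (walk-invariant (lookup A) (λ e → ∉∂⇒same-side {A = A} (none e)) p)) ([]=⇒lookup a∈A)))

  leave-start : Walk G W a b → a ≢ b → ∃[ e ] ∃[ w ] (Joins G e a w × Walk G (W - a) w b)
  leave-start (stop _)           a≢b = ⊥-elim (a≢b refl)
  leave-start {W} {a} {b} (step e j _ p) a≢b with avoid p
    where
    avoid : ∀ {u} → Walk G W u b →
      Walk G (W - a) u b ⊎ ∃[ e ] ∃[ w ] (Joins G e a w × Walk G (W - a) w b)
    avoid (stop b∈W) = inj₁ (stop (x∈p∧x≢y⇒x∈p-y b∈W (a≢b ∘ sym)))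
    avoid {u} (step e j u∈W q) with avoid q
    ... | inj₂ r = inj₂ r
    ... | inj₁ q′ with u ≟ a
    ...   | yes refl = inj₂ (e , _ , j , q′)
    ...   | no  u≢a  = inj₁ (step e j (x∈p∧x≢y⇒x∈p-y u∈W u≢a) q′)
  ... | inj₁ q = e , _ , j , q
  ... | inj₂ r = r

  walk? : ∀ W a b → Dec (Walk G W a b)
  walk? W = go W (⊂-wellFounded W)
    where
    joins? : ∀ e u w → Dec (Joins G e u w)
    joins? e u w = ≡-dec _≟_ _≟_ (ends G e) (u , w) ⊎-dec ≡-dec _≟_ _≟_ (ends G e) (w , u)
    go : ∀ W → Acc _⊂_ W → ∀ a b → Dec (Walk G W a b)
    go W (acc smaller) a b with a ∈? W | a ≟ b
    ... | no a∉W  | _        = no (a∉W ∘ walk-start)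
    ... | yes a∈W | yes refl = yes (stop a∈W)
    ... | yes a∈W | no a≢b   =
      map′ (λ (e , w , j , q) → step e j a∈W (walk-mono (p─q⊆p W _) q))
           (λ p → leave-start p a≢b)
           (any? λ e → any? λ w → joins? e a w ×-dec go (W - a) (smaller (x∈p⇒p-x⊂p a∈W)) w b)

  component : Subset n → Fin n → Subset n
  component W a = tabulate (λ b → does (walk? W a b))

  ∈component⁺ : Walk G W a b → b ∈ component W a
  ∈component⁺ {W} {a} {b} p = ∈-tabulate⁺ (dec-true (walk? W a b) p)

  ∈component⁻ : b ∈ component W a → Walk G W a b
  ∈component⁻ {b = b} {W = W} {a = a} b∈ with walk? W a b | ∈-tabulate⁻ {x = b} b∈
  ... | yes p | _  = p
  ... | no  _ | ()

  component-IsComponent : a ∈ W → IsComponent G W (component W a)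
  component-IsComponent {a} {W} a∈W =
      walk-end ∘ from
    , (_ , ∈component⁺ (stop a∈W))
    , (λ b∈ c∈ → walk-++ (walk-reverse (from b∈)) (from c∈))
    , (λ b∈ p → ∈component⁺ (walk-++ (from b∈) p))
    where
    from : ∀ {b} → b ∈ component W a → Walk G W a b
    from = ∈component⁻ {W = W} {a = a}

  components-⊆-or-disjoint : IsComponent G W K → IsComponent G W A → K ⊆ A ⊎ Empty (K ∩ A)
  components-⊆-or-disjoint {K = K} {A = A} (_ , _ , K-connected , _) (_ , _ , _ , A-closed)
    with nonempty? (K ∩ A)
  ... | no  K∩A≡∅     = inj₂ K∩A≡∅
  ... | yes (c , c∈K∩A) =
    let c∈K , c∈A = x∈p∩q⁻ K A c∈K∩A in inj₁ λ b∈K → A-closed c∈A (K-connected c∈K b∈K)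

  component-misses : IsComponent G W K → a ∈ W → b ∈ W → ¬ Walk G W a b → Nonempty (W ─ K)
  component-misses {K = K} {a = a} {b = b} (_ , _ , K-connected , _) a∈W b∈W ¬a⇝b with a ∈? K | b ∈? K
  ... | no  a∉K | _       = a , x∈p∧x∉q⇒x∈p─q a∈W a∉K
  ... | yes _   | no  b∉K = b , x∈p∧x∉q⇒x∈p─q b∈W b∉K
  ... | yes a∈K | yes b∈K = ⊥-elim (¬a⇝b (K-connected a∈K b∈K))

  ∂-∁ : ∀ A → ∂ G (∁ A) ≡ ∂ G A
  ∂-∁ A = tabulate-cong λ e →
    trans (cong₂ _xor_ (lookup-map (end₁ e) not A) (lookup-map (end₂ e) not A))
          (not-xor-not (lookup A (end₁ e)) (lookup A (end₂ e)))

  ∈∂⇒Nonempty : ∀ {e} → e ∈ ∂ G A → Nonempty A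
  ∈∂⇒Nonempty {A} {e} e∈∂A with lookup A (end₁ e) in eq | trans (sym (lookup-∂ A e)) ([]=⇒lookup e∈∂A)
  ... | true  | _      = end₁ e , lookup⇒[]= _ A eq
  ... | false | end₂∈A = end₂ e , lookup⇒[]= _ A end₂∈A

  shore-unique : Connected G → ∂ G X′ ≡ ∂ G X → lookup X′ x ≡ lookup X x → X′ ≡ X
  shore-unique {X′} {X} {x} connected ∂X′≡∂X agree-at-x = ≗⇒≡ λ y →
    xor≡false⇒≡ (trans (walk-invariant D same-on-edges (connected y x))
                       (trans (cong (_xor lookup X x) agree-at-x) (xor-same (lookup X x))))
    where
    D : Fin n → Bool
    D y = lookup X′ y xor lookup X y
    same-on-edges : ∀ e → D (end₁ e) ≡ D (end₂ e)
    same-on-edges e = xor-interchange (lookup X′ (end₁ e)) _ _ _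
      (trans (sym (lookup-∂ X′ e)) (trans (cong (λ C → lookup C e) ∂X′≡∂X) (lookup-∂ X e)))

  shore-or-coshore : Connected G → ∂ G X′ ≡ ∂ G X → (x : Fin n) → X′ ≡ X ⊎ X′ ≡ ∁ X
  shore-or-coshore {X′} {X} connected ∂X′≡∂X x with lookup X′ x Bool.≟ lookup X x
  ... | yes agree = inj₁ (shore-unique connected ∂X′≡∂X agree)
  ... | no  differ = inj₂ (shore-unique connected (trans ∂X′≡∂X (sym (∂-∁ X)))
                                        (trans (¬-not differ) (sym (lookup-map x not X))))

  ∣∂∩∣≡count : ∀ A M (f : Fin n → Bool) → lookup A ≗ f →
    ∣ ∂ G A ∩ M ∣ ≡ count (λ e → (f (end₁ e) xor f (end₂ e)) ∧ lookup M e)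
  ∣∂∩∣≡count A M f A≗f = trans (∣p∣≡count (∂ G A ∩ M)) (count-cong λ e →
    trans (lookup-zipWith _∧_ e (∂ G A) M)
          (cong (_∧ lookup M e) (trans (lookup-∂ A e) (cong₂ _xor_ (A≗f (end₁ e)) (A≗f (end₂ e))))))

  count-incident : ∀ (f : Fin n → Bool) e →
    count (λ v → f v ∧ incident G v e) ≡ toℕ (f (end₁ e)) + toℕ (f (end₂ e))
  count-incident f e = begin
    count (λ v → f v ∧ incident G v e)           ≡⟨ sum-cong-≗ split-at-ends ⟩
    sum (λ v → at end₁ v + at end₂ v)            ≡⟨ ∑-distrib-+ (at end₁) (at end₂) ⟩
    sum (at end₁) + sum (at end₂)                ≡⟨ cong₂ _+_ (count-indicator f (end₁ e))
                                                              (count-indicator f (end₂ e)) ⟩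
    toℕ (f (end₁ e)) + toℕ (f (end₂ e))          ∎
    where
    open ≡-Reasoning
    at : (Fin m → Fin n) → Fin n → ℕ
    at end v = toℕ (does (end e ≟ v) ∧ f v)
    split-at-ends : ∀ v → toℕ (f v ∧ (⌊ end₁ e ≟ v ⌋ ∨ ⌊ end₂ e ≟ v ⌋)) ≡ at end₁ v + at end₂ v
    split-at-ends v with end₁ e ≟ v | end₂ e ≟ v
    ... | yes refl | yes e₂≡v = ⊥-elim (loopless G e (sym e₂≡v))
    ... | yes _    | no  _    = trans (cong toℕ (∧-identityʳ (f v))) (sym (+-identityʳ _))
    ... | no  _    | yes _    = cong toℕ (∧-identityʳ (f v))
    ... | no  _    | no  _    = cong toℕ (∧-zeroʳ (f v))

  -- |A| = |M ∩ ∂A| + 2 |M ∩ E(A)|, by counting pairs (v, e) with v ∈ A and e ∈ M at v.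
  parity : ∀ {M} → PerfectMatching G M → ∀ A → ∃[ k ] ∣ A ∣ ≡ ∣ ∂ G A ∩ M ∣ + 2 * k
  parity {M} perfect A = count inside , (begin
    ∣ A ∣                                          ≡⟨ ∣p∣≡count A ⟩
    count in-A                                     ≡⟨ sum-cong-≗ degree-one ⟩
    sum (λ v → sum (λ e → incidence v e))          ≡⟨ ∑-comm incidence ⟩
    sum (λ e → sum (λ v → incidence v e))          ≡⟨ sum-cong-≗ matched-edge ⟩
    sum (λ e → toℕ (cut e) + 2 * toℕ (inside e))   ≡⟨ ∑-distrib-+ (toℕ ∘ cut) (λ e → 2 * toℕ (inside e)) ⟩
    count cut + sum (λ e → 2 * toℕ (inside e))     ≡⟨ cong₂ _+_ (sym (∣∂∩∣≡count A M in-A (λ _ → refl)))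
                                                                (sym (*-distribˡ-sum 2 (toℕ ∘ inside))) ⟩
    ∣ ∂ G A ∩ M ∣ + 2 * count inside               ∎)
    where
    open ≡-Reasoning
    in-A : Fin n → Bool
    in-A = lookup A
    cut inside : Fin m → Bool
    cut    e = (in-A (end₁ e) xor in-A (end₂ e)) ∧ lookup M e
    inside e = lookup M e ∧ (in-A (end₁ e) ∧ in-A (end₂ e))
    incidence : Fin n → Fin m → ℕ
    incidence v e = toℕ (in-A v ∧ (lookup M e ∧ incident G v e))
    degree-one : ∀ v → toℕ (in-A v) ≡ sum (incidence v)
    degree-one v with in-A v
    ... | true  = sym (trans (sym (∣tabulate∣≡count (λ e → lookup M e ∧ incident G v e))) (perfect v))
    ... | false = sym (count-false m)
    matched-ends : ∀ e → sum (λ v → incidence v e) ≡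
                         toℕ (lookup M e ∧ in-A (end₁ e)) + toℕ (lookup M e ∧ in-A (end₂ e))
    matched-ends e with lookup M e
    ... | true  = count-incident in-A e
    ... | false = trans (count-cong (λ v → ∧-zeroʳ (in-A v))) (count-false n)
    matched-edge : ∀ e → sum (λ v → incidence v e) ≡ toℕ (cut e) + 2 * toℕ (inside e)
    matched-edge e = trans (matched-ends e)
      (bits-of-matched-edge (lookup M e) (in-A (end₁ e)) (in-A (end₂ e)))

  Uncrossed : Subset n → Subset n → Set
  Uncrossed A K = ∀ e → end₁ e ∈ A → end₂ e ∈ A → lookup K (end₁ e) ≡ lookup K (end₂ e)

  ∂-split : Uncrossed A K → ∀ M → ∣ ∂ G A ∩ M ∣ ≡ ∣ ∂ G (A ∩ K) ∩ M ∣ + ∣ ∂ G (A ∩ ∁ K) ∩ M ∣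
  ∂-split {A} {K} uncrossed M = begin
    ∣ ∂ G A ∩ M ∣                                 ≡⟨ ∣∂∩∣≡count A M (lookup A) (λ _ → refl) ⟩
    count (cut (lookup A))                        ≡⟨ sum-cong-≗ split-edge ⟩
    sum (λ e → toℕ (cut in-K e) + toℕ (cut out-K e))
                                                  ≡⟨ ∑-distrib-+ (toℕ ∘ cut in-K) (toℕ ∘ cut out-K) ⟩
    count (cut in-K) + count (cut out-K)          ≡⟨ cong₂ _+_ (sym (∣∂∩∣≡count (A ∩ K) M in-K A∩K≗in-K))
                                                                (sym (∣∂∩∣≡count (A ∩ ∁ K) M out-K A∩∁K≗out-K)) ⟩
    ∣ ∂ G (A ∩ K) ∩ M ∣ + ∣ ∂ G (A ∩ ∁ K) ∩ M ∣   ∎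
    where
    open ≡-Reasoning
    cut : (Fin n → Bool) → Fin m → Bool
    cut f e = (f (end₁ e) xor f (end₂ e)) ∧ lookup M e
    in-K out-K : Fin n → Bool
    in-K  v = lookup A v ∧ lookup K v
    out-K v = lookup A v ∧ not (lookup K v)
    A∩K≗in-K : lookup (A ∩ K) ≗ in-K
    A∩K≗in-K v = lookup-zipWith _∧_ v A K
    A∩∁K≗out-K : lookup (A ∩ ∁ K) ≗ out-K
    A∩∁K≗out-K v = trans (lookup-zipWith _∧_ v A (∁ K)) (cong (lookup A v ∧_) (lookup-map v not K))
    split-edge : ∀ e → toℕ (cut (lookup A) e) ≡ toℕ (cut in-K e) + toℕ (cut out-K e)
    split-edge e = bits-of-split-edge (lookup M e) _ _ _ _ λ p q →
      uncrossed e (lookup⇒[]= _ A p) (lookup⇒[]= _ A q)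

  -- Parity makes |M ∩ ∂A| constant mod 2, and matching-coveredness provides an M meeting ∂A.
  ≤1⇒Tight : MatchingCovered G → a ∈ A → s ∉ A →
    (∀ M → PerfectMatching G M → ∣ ∂ G A ∩ M ∣ ≤ 1) → Tight G (∂ G A)
  ≤1⇒Tight {a} {A} {s} (connected , _ , covered) a∈A s∉A ≤1 M perfect =
    let e , e∈∂A = walk-leaves (connected a s) a∈A s∉A
        Mₑ , perfectₑ , e∈Mₑ = covered e
        k , ∣A∣≡ = parity perfect A
        kₑ , ∣A∣≡ₑ = parity perfectₑ A
        hitₑ = ≤-antisym (≤1 Mₑ perfectₑ) (∈⇒1≤∣p∣ (x∈p∩q⁺ (e∈∂A , e∈Mₑ)))
    in odd-≤1⇒≡1 {k = k} {k′ = kₑ} (≤1 M perfect)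
         (trans (sym ∣A∣≡) (trans ∣A∣≡ₑ (cong (_+ 2 * kₑ) hitₑ)))

  tight-shore-unsplit : MatchingCovered G → Tight G (∂ G X) → s ∉ X → Uncrossed X K →
    x ∈ X ∩ K → y ∈ X ∩ ∁ K → ⊥
  tight-shore-unsplit {X} {s} {K} mc@(_ , e₀ , covered) tight s∉X uncrossed x∈X∩K y∈X∩∁K
    = 2≢1 (trans (sym (cong₂ _+_ (tight₁ M₀ perfect₀) (tight₂ M₀ perfect₀))) (halves M₀ perfect₀))
    where
    2≢1 : 1 + 1 ≢ 1
    2≢1 ()
    halves : ∀ M → PerfectMatching G M → ∣ ∂ G (X ∩ K) ∩ M ∣ + ∣ ∂ G (X ∩ ∁ K) ∩ M ∣ ≡ 1
    halves M perfect = trans (sym (∂-split uncrossed M)) (tight M perfect)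
    tight₁ : Tight G (∂ G (X ∩ K))
    tight₁ = ≤1⇒Tight mc x∈X∩K (s∉X ∘ p∩q⊆p X K) λ M perfect →
      subst (∣ ∂ G (X ∩ K) ∩ M ∣ ≤_) (halves M perfect) (m≤m+n _ _)
    tight₂ : Tight G (∂ G (X ∩ ∁ K))
    tight₂ = ≤1⇒Tight mc y∈X∩∁K (s∉X ∘ p∩q⊆p X (∁ K)) λ M perfect →
      subst (∣ ∂ G (X ∩ ∁ K) ∩ M ∣ ≤_) (halves M perfect) (m≤n+m _ _)
    M₀ : Subset m
    M₀ = proj₁ (covered e₀)
    perfect₀ : PerfectMatching G M₀
    perfect₀ = proj₁ (proj₂ (covered e₀))

  tight-shore-⊆ : MatchingCovered G → Tight G (∂ G X) → s ∉ X → Uncrossed X K →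
    x ∈ X → x ∈ K → X ⊆ K
  tight-shore-⊆ {X} {s} {K} mc tight s∉X uncrossed x∈X x∈K {y} y∈X with y ∈? K
  ... | yes y∈K = y∈K
  ... | no  y∉K = ⊥-elim (tight-shore-unsplit mc tight s∉X uncrossed
                            (x∈p∩q⁺ (x∈X , x∈K)) (x∈p∩q⁺ (y∈X , x∉p⇒x∈∁p y∉K)))

  Tight⇒Nonempty : MatchingCovered G → Tight G (∂ G A) → Nonempty A
  Tight⇒Nonempty {A} (_ , e₀ , covered) tight =
    let M₀ , perfect₀ , _ = covered e₀
        e , e∈∂A∩M₀ = 1≤∣p∣⇒Nonempty (≤-reflexive (sym (tight M₀ perfect₀)))
    in ∈∂⇒Nonempty (proj₁ (x∈p∩q⁻ (∂ G A) M₀ e∈∂A∩M₀))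

  2sep-∈ : ∀ {u v} → Is2SepPair G u v S → u ∈ S
  2sep-∈ {u = u} (_ , S≡⁅u⁆∪⁅v⁆ , _) = subst (u ∈_) (sym S≡⁅u⁆∪⁅v⁆) (x∈p∪q⁺ (inj₁ (x∈⁅x⁆ u)))

  2sep⊎barrier⇒Nonempty : Is2Sep G S ⊎ IsBarrier G S → Nonempty S
  2sep⊎barrier⇒Nonempty (inj₁ (u , _ , 2sep)) = u , 2sep-∈ 2sep
  2sep⊎barrier⇒Nonempty (inj₂ (nonempty , _)) = nonempty

  ⊆∁-swap : S ⊆ ∁ X → X ⊆ ∁ S
  ⊆∁-swap S⊆∁X y∈X = x∉p⇒x∈∁p λ y∈S → x∈∁p⇒x∉p (S⊆∁X y∈S) y∈X

  edge-walk : ∀ e → end₁ e ∈ W → end₂ e ∈ W → Walk G W (end₁ e) (end₂ e)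
  edge-walk e end₁∈W end₂∈W = step e (inj₁ refl) end₁∈W (stop end₂∈W)

  component-Uncrossed : IsComponent G W K → A ⊆ W → Uncrossed A K
  component-Uncrossed {K = K} (_ , _ , _ , K-closed) A⊆W e end₁∈A end₂∈A
    with end₁ e ∈? K | end₂ e ∈? K
  ... | yes end₁∈K | yes end₂∈K = trans ([]=⇒lookup end₁∈K) (sym ([]=⇒lookup end₂∈K))
  ... | no  end₁∉K | no  end₂∉K = trans (∉⇒lookup≡false end₁∉K) (sym (∉⇒lookup≡false end₂∉K))
  ... | yes end₁∈K | no  end₂∉K =
    ⊥-elim (end₂∉K (K-closed end₁∈K (edge-walk e (A⊆W end₁∈A) (A⊆W end₂∈A))))
  ... | no  end₁∉K | yes end₂∈K =
    ⊥-elim (end₁∉K (K-closed end₂∈K (walk-reverse (edge-walk e (A⊆W end₁∈A) (A⊆W end₂∈A)))))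

  shore-⊆-component : MatchingCovered G → Tight G (∂ G X) → s ∈ S → S ⊆ ∁ X → x ∈ X →
    X ⊆ component (∁ S) x
  shore-⊆-component {S = S} {x = x} mc tight s∈S S⊆∁X x∈X =
    tight-shore-⊆ mc tight (x∈∁p⇒x∉p (S⊆∁X s∈S))
      (component-Uncrossed (component-IsComponent x∈∁S) (⊆∁-swap S⊆∁X))
      x∈X (∈component⁺ (stop x∈∁S))
    where
    x∈∁S : x ∈ ∁ S
    x∈∁S = ⊆∁-swap S⊆∁X x∈X

  assoc-shore-⊇-component : Is2Sep G S ⊎ IsBarrier G S → x ∈ ∁ S →
    ∃[ Y ] (AssocShore G S Y × component (∁ S) x ⊆ Y)
  assoc-shore-⊇-component {S} {x} (inj₂ barrier) x∈∁S =
    component (∁ S) x , inj₂ (barrier , component-IsComponent x∈∁S) , id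
  assoc-shore-⊇-component {S} {x} (inj₁ (u , v , 2sep@(_ , _ , (a , b , a∈∁S , b∈∁S , ¬a⇝b) , _))) x∈∁S =
      Kₓ ∪ ⁅ u ⁆
    , inj₁ (u , v , 2sep , Kₓ
           , (proj₁ Kₓ-component ,
              λ K′ K′-component → components-⊆-or-disjoint K′-component Kₓ-component)
           , (x , ∈component⁺ (stop x∈∁S))
           , component-misses Kₓ-component a∈∁S b∈∁S ¬a⇝b
           , refl)
    , p⊆p∪q ⁅ u ⁆
    where
    Kₓ : Subset n
    Kₓ = component (∁ S) x
    Kₓ-component : IsComponent G (∁ S) Kₓ
    Kₓ-component = component-IsComponent x∈∁S

  assoc-shore-dichotomy : IsComponent G (∁ S) K → X ⊆ K → S ⊆ ∁ X → AssocShore G S Y →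
    Y ⊆ ∁ X ⊎ X ⊆ Y
  assoc-shore-dichotomy K-component X⊆K S⊆∁X (inj₂ (_ , Y-component))
    with components-⊆-or-disjoint K-component Y-component
  ... | inj₁ K⊆Y   = inj₂ (K⊆Y ∘ X⊆K)
  ... | inj₂ K∩Y≡∅ = inj₁ (⊆-Empty∩⇒⊆∁ X⊆K K∩Y≡∅)
  assoc-shore-dichotomy {K = K} K-component X⊆K S⊆∁X
    (inj₁ (u , _ , 2sep , X₁ , (_ , components) , _ , _ , refl)) with components K K-component
  ... | inj₁ K⊆X₁   = inj₂ (p⊆p∪q ⁅ u ⁆ ∘ K⊆X₁ ∘ X⊆K)
  ... | inj₂ K∩X₁≡∅ = inj₁ λ y∈ →
    [ ⊆-Empty∩⇒⊆∁ X⊆K K∩X₁≡∅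
    , (λ y∈⁅u⁆ → S⊆∁X (subst (_∈ _) (sym (x∈⁅y⁆⇒x≡y u y∈⁅u⁆)) (2sep-∈ 2sep))) ]′ (x∈p∪q⁻ X₁ ⁅ u ⁆ y∈)

  sheltered-shores : MatchingCovered G → Tight G (∂ G X) → Is2Sep G S ⊎ IsBarrier G S →
    S ⊆ ∁ X → x ∈ X →
    (∃[ Y ] (AssocShore G S Y × X ⊆ Y)) × (∀ {Y} → AssocShore G S Y → Y ⊆ ∁ X ⊎ X ⊆ Y)
  sheltered-shores {S = S} {x = x} mc tight 2sep⊎barrier S⊆∁X x∈X =
    let s , s∈S = 2sep⊎barrier⇒Nonempty 2sep⊎barrier
        X⊆K = shore-⊆-component mc tight s∈S S⊆∁X x∈X
        Y , assocY , K⊆Y = assoc-shore-⊇-component 2sep⊎barrier x∈∁S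
    in (Y , assocY , K⊆Y ∘ X⊆K) , assoc-shore-dichotomy (component-IsComponent x∈∁S) X⊆K S⊆∁X
    where
    x∈∁S : x ∈ ∁ S
    x∈∁S = ⊆∁-swap S⊆∁X x∈X

  ⊆∁⊎⊇⇒Laminar : Y ⊆ ∁ X ⊎ X ⊆ Y → Laminar G Y X
  ⊆∁⊎⊇⇒Laminar (inj₁ Y⊆∁X) = inj₁ (⊆∁⇒Empty∩ Y⊆∁X)
  ⊆∁⊎⊇⇒Laminar (inj₂ X⊆Y)  = inj₂ (inj₁ (⊆∁⇒Empty∩ (p⊆q⇒∁p⊇∁q X⊆Y)))

  ⊆∁⊎⊇⇒⊆∁ : Y ⊆ ∁ X ⊎ X ⊆ Y → ∃[ Z ] (∂ G Z ≡ ∂ G Y × Z ⊆ ∁ X)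
  ⊆∁⊎⊇⇒⊆∁ {Y} (inj₁ Y⊆∁X) = Y , refl , Y⊆∁X
  ⊆∁⊎⊇⇒⊆∁ {Y} (inj₂ X⊆Y)  = ∁ Y , ∂-∁ Y , p⊆q⇒∁p⊇∁q X⊆Y

  Laminar-∁ʳ : Laminar G Y X → Laminar G Y (∁ X)
  Laminar-∁ʳ (inj₁ Y∩X≡∅)                 = inj₂ (inj₂ (inj₁ (Empty∩∁∁ Y∩X≡∅)))
  Laminar-∁ʳ (inj₂ (inj₁ ∁Y∩X≡∅))         = inj₂ (inj₂ (inj₂ (Empty∩∁∁ ∁Y∩X≡∅)))
  Laminar-∁ʳ (inj₂ (inj₂ (inj₁ Y∩∁X≡∅)))  = inj₁ Y∩∁X≡∅
  Laminar-∁ʳ (inj₂ (inj₂ (inj₂ ∁Y∩∁X≡∅))) = inj₂ (inj₁ ∁Y∩∁X≡∅)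

  Laminar-same-cut : Connected G → ∂ G X′ ≡ ∂ G X → Fin n → Laminar G Y X → Laminar G Y X′
  Laminar-same-cut {X′} {X} connected ∂X′≡∂X x laminar
    with shore-or-coshore {X′} {X} connected ∂X′≡∂X x
  ... | inj₁ refl = laminar
  ... | inj₂ refl = Laminar-∁ʳ laminar

proposition1p10 : {n m : ℕ} (G : Graph n m) → MatchingCovered G
    → (C : Subset m) → IsCut G C → Tight G C
    → (S : Subset n) → Is2Sep G S ⊎ IsBarrier G S
    → Sheltered G S C
    → (∃[ Y ] (AssocShore G S Y × ∃[ X ] (IsShore G C X
         × ∃[ Y₀ ] (∂ G Y₀ ≡ ∂ G Y × X ⊆ Y₀)
         × (∀ Y′ → AssocShore G S Y′ → ∂ G Y′ ≢ ∂ G Y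
              → ∃[ Z ] (∂ G Z ≡ ∂ G Y′ × Z ⊆ ∁ X)))))
      × Avoiding G S C
proposition1p10 G mc@(connected , _) C _ tight S 2sep⊎barrier (Z , ∂Z≡C , S⊆Z) =
  let x , x∈X = Tight⇒Nonempty G mc tightX
      (Y , assocY , X⊆Y) , dichotomy = sheltered-shores G mc tightX 2sep⊎barrier S⊆∁X x∈X
  in (Y , assocY , X , ∂X≡C , Y , (refl , X⊆Y) , λ _ assoc _ → ⊆∁⊎⊇⇒⊆∁ G (dichotomy assoc))
   , λ _ assoc _ ∂X′≡C →
       Laminar-same-cut G connected (trans ∂X′≡C (sym ∂X≡C)) x (⊆∁⊎⊇⇒Laminar G (dichotomy assoc))
  where
  X : Subset _
  X = ∁ Z
  ∂X≡C : ∂ G X ≡ C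
  ∂X≡C = trans (∂-∁ G Z) ∂Z≡C
  tightX : Tight G (∂ G X)
  tightX = subst (Tight G) (sym ∂X≡C) tight
  S⊆∁X : S ⊆ ∁ X
  S⊆∁X = subst (S ⊆_) (sym (∁-involutive Z)) S⊆Z
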